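{- Let $\gamma\in G(r,n)$ with $r\ge2$. Then \[ \sum_{f\in\mathbb N_0^{(r,n)}:\ \pi(f)=\phi(\gamma)}t^{\max(f)}q^{n\max(f)-|f|}=\sum_{f\in\mathbb N_0^{(r,n)}:\ \pi(f)=\gamma}t^{\max(f)}q^{n\max(f)-|f|}. \]
   Context: $G(r,n)$ is the set of $r$-colored permutations $\gamma=(c_1,\dots,c_n;\sigma)$, $c_i\in\{0,\dots,r-1\}$, $\sigma\in S_n$, written $\gamma=[\gamma(1),\dots,\gamma(n)]=[\sigma(1)^{c_1},\dots,\sigma(n)^{c_n}]$. The projection $\phi(\gamma)=(\hat c_1,\dots,\hat c_n;\sigma)$ has $\hat c_i=0$ if $c_i=0$ and $\hat c_i=1$ if $c_i\ge1$; it is an element of $B_n=G(2,n)$, regarded here as an element of $G(r,n)$ with colors in $\{0,1\}$. Colored integers $x^c$ ($x^0=x$) are totally ordered by: uncolored integers in natural order; every $x^c$ with $c\ge1$ is smaller than every uncolored integer (including $0$); for $c,d\ge1$, $x^c<y^d$ iff $x>y$, or $x=y$ and $c>d$. $\mathbb N_0^{(r,n)}$ is the set of $n$-tuples $f=(f_1^{c_1},\dots,f_n^{c_n})$ with $f_i\in\mathbb N$, $c_i\in\{0,\dots,r-1\}$, $c_i=0$ whenever $f_i=0$; $\max(f)=\max_if_i$, $|f|=\sum_if_i$. For such $f$ and $\nu\in\mathbb N$ let $A_\nu=\{i^{c_i}:f_i=\nu\}$; arranging each nonempty $A_\nu$ increasingly and juxtaposing blocks in order of increasing $\nu$ gives the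 window notation of $\pi(f)\in G(r,n)$. -}

module Defs where

open import Data.Nat using (ℕ; zero; suc; _+_; _*_; _∸_; _⊔_; _≤_; _<ᵇ_; _≡ᵇ_; s≤s; z≤n)
import Data.Bool
import Data.Fin as Fin
open import Data.Bool using (Bool; true; false; _∧_; _∨_; if_then_else_)
open import Data.Fin using (Fin; toℕ; fromℕ<)
open import Data.Fin.Permutation using (Permutation′; _⟨$⟩ʳ_)
open import Data.Product using (_×_; _,_; proj₁; proj₂)
open import Data.List using (List; []; _∷_; map; filter; length; foldr; upTo; cartesianProduct; concatMap; allFin)
open import Data.Vec using (Vec; []; _∷_; toList; tabulate; lookup; zip)
open import Relation.Nullary.Decidable using (Dec; yes; no)
open import Relation.Binary.PropositionalEquality using (_≡_)

-- A colored integer x^c is encoded as the pair (x , c).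
ColInt : Set
ColInt = ℕ × ℕ

_<ᶜ_ : ColInt → ColInt → Bool
(x , zero)  <ᶜ (y , zero)  = x <ᵇ y
(x , suc _) <ᶜ (y , zero)  = true
(x , zero)  <ᶜ (y , suc _) = false
(x , suc c) <ᶜ (y , suc d) = (y <ᵇ x) ∨ ((x ≡ᵇ y) ∧ (d <ᵇ c))

record ColPerm (r n : ℕ) : Set where
  constructor colperm
  field
    colors : Fin n → Fin r
    perm   : Permutation′ n

window : ∀ {r n} → ColPerm r n → List ColInt
window {r} {n} γ =
  toList (tabulate {n = n} λ i → (suc (toℕ (ColPerm.perm γ ⟨$⟩ʳ i)) , toℕ (ColPerm.colors γ i)))

-- The projection φ : G(r,n) → B_n ⊆ G(r,n) (needs r ≥ 2 so that color 1 exists).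
phi : ∀ {r n} → 2 ≤ r → ColPerm r n → ColPerm r n
phi {suc (suc r')} {n} (s≤s (s≤s _)) γ = colperm hat (ColPerm.perm γ)
  where
    hat : Fin n → Fin (suc (suc r'))
    hat i with ColPerm.colors γ i
    ... | Fin.zero  = Fin.zero
    ... | Fin.suc _ = Fin.suc Fin.zero

-- Elements f = (f_1^{c_1},…,f_n^{c_n}) of N_0^{(r,n)} are encoded as vectors of
-- pairs (f_i , c_i) with c_i : Fin r; membership additionally requires the
-- side condition c_i = 0 whenever f_i = 0 (checked by `valid`).
Entry : ℕ → Set
Entry r = ℕ × Fin r

isZeroFin : ∀ {r} → Fin r → Bool
isZeroFin Fin.zero    = true
isZeroFin (Fin.suc _) = false

validEntry : ∀ {r} → Entry r → Bool
validEntry (zero  , c) = isZeroFin c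
validEntry (suc _ , c) = true

valid : ∀ {r n} → Vec (Entry r) n → Bool
valid f = foldr (λ e b → validEntry e ∧ b) true (toList f)

maxF : ∀ {r n} → Vec (Entry r) n → ℕ
maxF f = foldr (λ e m → proj₁ e ⊔ m) 0 (toList f)

sizeF : ∀ {r n} → Vec (Entry r) n → ℕ
sizeF f = foldr (λ e m → proj₁ e + m) 0 (toList f)

keyLt : ℕ × ColInt → ℕ × ColInt → Bool
keyLt (ν , a) (μ , b) = (ν <ᵇ μ) ∨ ((ν ≡ᵇ μ) ∧ (a <ᶜ b))

insertKey : ℕ × ColInt → List (ℕ × ColInt) → List (ℕ × ColInt)
insertKey x [] = x ∷ []
insertKey x (y ∷ ys) = if keyLt x y then x ∷ y ∷ ys else y ∷ insertKey x ys

sortKeys : List (ℕ × ColInt) → List (ℕ × ColInt)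
sortKeys = foldr insertKey []

piF : ∀ {r n} → Vec (Entry r) n → List ColInt
piF {r} {n} f = map proj₂ (sortKeys (toList (tabulate {n = n} λ i →
  (proj₁ (lookup f i) , (suc (toℕ i) , toℕ (proj₂ (lookup f i)))))))

eqCol : ColInt → ColInt → Bool
eqCol (x , c) (y , d) = (x ≡ᵇ y) ∧ (c ≡ᵇ d)

eqWin : List ColInt → List ColInt → Bool
eqWin [] [] = true
eqWin (a ∷ as) (b ∷ bs) = eqCol a b ∧ eqWin as bs
eqWin _ _ = false

vecsOf : ∀ {A : Set} (n : ℕ) → List A → List (Vec A n)
vecsOf zero    xs = [] ∷ []
vecsOf (suc n) xs = concatMap (λ x → map (x ∷_) (vecsOf n xs)) xs

-- All candidate f with every f_i ≤ m (a finite superset of {f : max f = m}).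
candidates : (r n m : ℕ) → List (Vec (Entry r) n)
candidates r n m = vecsOf n (cartesianProduct (upTo (suc m)) (allFin r))

-- Coefficient of t^m q^k in  Σ_{f ∈ N_0^{(r,n)}, π(f) = γ} t^{max f} q^{n max f − |f|},
-- i.e. the number of f ∈ N_0^{(r,n)} with π(f) = γ, max f = m, n·m − |f| = k.
coeff : ∀ {r n} → ColPerm r n → ℕ → ℕ → ℕ
coeff {r} {n} γ m k = length (filter (λ f →
  (valid f ∧ eqWin (piF f) (window γ) ∧ (maxF f ≡ᵇ m) ∧ ((n * m ∸ sizeF f) ≡ᵇ k)) Data.Bool.≟ true)
  (candidates r n m))

module Submission where

-- A function f with π(f) = γ must give the letter i the colour that i carries in γ, so
-- both sides count the same value vectors (f₁,…,fₙ), coloured as γ, resp. φ(γ), dictates.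
-- For fixed values, validity, max f and |f| only see whether a colour vanishes. The
-- insertion sort defining π(f) only compares keys with distinct letters, and on those the
-- coloured order only sees whether colours vanish; hence π commutes with flattening every
-- nonzero colour to 1. Window entries are determined by their letters, so π(f) = γ can be
-- tested after flattening, where γ and φ(γ) coincide.

open import Defs
open import Data.Bool using (Bool; true; false; _∧_; _≟_)
open import Data.Bool.Properties using (T-≡; ⇔→≡; ∧-conicalˡ; ∧-conicalʳ)
open import Data.Empty using (⊥-elim)
open import Data.Fin using (Fin; toℕ)
import Data.Fin as Fin
open import Data.Fin.Permutation using (_⟨$⟩ʳ_; _⟨$⟩ˡ_; inverseˡ)
import Data.Fin.Properties as Finₚ
open import Data.List using (List; []; _∷_; _++_; map; filter; length; concatMap; cartesianProduct; allFin; upTo)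
import Data.List as List
open import Data.List.Properties
  using (map-++; map-∘; map-cong; map-tabulate; tabulate-cong; ∷-injectiveˡ; ∷-injectiveʳ)
open import Data.List.Membership.Propositional using (_∈_)
open import Data.List.Membership.Propositional.Properties using (∈-map⁺; ∈-tabulate⁺)
open import Data.List.Relation.Binary.Permutation.Propositional using (_↭_; refl; prep; swap; trans; ↭-sym)
open import Data.List.Relation.Binary.Permutation.Propositional.Properties using (All-resp-↭; ∈-resp-↭)
open import Data.List.Relation.Unary.All as All using (All; []; _∷_)
import Data.List.Relation.Unary.All.Properties as Allₚ
open import Data.List.Relation.Unary.AllPairs as AllPairs using (AllPairs; []; _∷_)
import Data.List.Relation.Unary.AllPairs.Properties as AllPairsₚ
open import Data.Nat using (ℕ; zero; suc; _+_; _*_; _∸_; _⊔_; _≤_; _≡ᵇ_; s≤s)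
open import Data.Nat.ListAction using (sum)
open import Data.Nat.ListAction.Properties using (sum-++)
open import Data.Nat.Properties using (≡ᵇ⇒≡; ≡⇒≡ᵇ; +-identityʳ)
import Data.Nat.Properties as ℕₚ
open import Data.Product using (_×_; _,_; proj₁; proj₂; Σ-syntax)
open import Data.Vec using (Vec; toList; tabulate; lookup)
import Data.Vec as Vec
open import Data.Vec.Properties using (lookup∘tabulate)
open import Data.Vec.Relation.Binary.Pointwise.Inductive as Pointwise using (Pointwise; []; _∷_)
open import Function using (_∘_; _⇔_; Equivalence; mk⇔)
import Function.Properties.Equivalence as ⇔
open import Relation.Nullary.Decidable using (dec-false)
open import Relation.Binary.PropositionalEquality
  using (_≡_; _≢_; refl; cong; cong₂; subst; module ≡-Reasoning)
import Relation.Binary.PropositionalEquality as ≡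

private
  variable
    A B : Set
    r n : ℕ

indicator : Bool → ℕ
indicator true  = 1
indicator false = 0

length-filter≡sum-indicator : (P : A → Bool) (xs : List A) →
  length (filter (λ x → P x ≟ true) xs) ≡ sum (map (indicator ∘ P) xs)
length-filter≡sum-indicator P [] = refl
length-filter≡sum-indicator P (x ∷ xs) with P x
... | true  = cong suc (length-filter≡sum-indicator P xs)
... | false = length-filter≡sum-indicator P xs

sum-map-cong : {g h : A → ℕ} → (∀ x → g x ≡ h x) → (xs : List A) → sum (map g xs) ≡ sum (map h xs)
sum-map-cong e xs = cong sum (map-cong e xs)

sum-map-≡0 : {h : A → ℕ} → (∀ x → h x ≡ 0) → (xs : List A) → sum (map h xs) ≡ 0
sum-map-≡0 e []       = refl
sum-map-≡0 e (x ∷ xs) = cong₂ _+_ (e x) (sum-map-≡0 e xs)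

sum-map-++ : (h : A → ℕ) (xs ys : List A) → sum (map h (xs ++ ys)) ≡ sum (map h xs) + sum (map h ys)
sum-map-++ h xs ys = ≡.trans (cong sum (map-++ h xs ys)) (sum-++ (map h xs) (map h ys))

sum-map-concatMap : (h : B → ℕ) (g : A → List B) (xs : List A) →
  sum (map h (concatMap g xs)) ≡ sum (map (λ x → sum (map h (g x))) xs)
sum-map-concatMap h g []       = refl
sum-map-concatMap h g (x ∷ xs) =
  ≡.trans (sum-map-++ h (g x) (concatMap g xs)) (cong (sum (map h (g x)) +_) (sum-map-concatMap h g xs))

sum-map-cartesianProduct : (h : A × B → ℕ) (xs : List A) (ys : List B) →
  sum (map h (cartesianProduct xs ys)) ≡ sum (map (λ x → sum (map (λ y → h (x , y)) ys)) xs)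
sum-map-cartesianProduct h []       ys = refl
sum-map-cartesianProduct h (x ∷ xs) ys = begin
  sum (map h (map (x ,_) ys ++ cartesianProduct xs ys))
    ≡⟨ sum-map-++ h (map (x ,_) ys) (cartesianProduct xs ys) ⟩
  sum (map h (map (x ,_) ys)) + sum (map h (cartesianProduct xs ys))
    ≡⟨ cong₂ _+_ (cong sum (≡.sym (map-∘ ys))) (sum-map-cartesianProduct h xs ys) ⟩
  sum (map (λ y → h (x , y)) ys) + sum (map (λ x → sum (map (λ y → h (x , y)) ys)) xs)
    ∎
  where open ≡-Reasoning

sum-map-vecsOf-suc : (h : Vec A (suc n) → ℕ) (xs : List A) →
  sum (map h (vecsOf (suc n) xs)) ≡ sum (map (λ x → sum (map (h ∘ (x Vec.∷_)) (vecsOf n xs))) xs)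
sum-map-vecsOf-suc {n = n} h xs = ≡.trans
  (sum-map-concatMap h (λ x → map (x Vec.∷_) (vecsOf n xs)) xs)
  (sum-map-cong (λ x → cong sum (≡.sym (map-∘ (vecsOf n xs)))) xs)

sum-tabulate-≡0 : (g : Fin n → ℕ) → (∀ j → g j ≡ 0) → sum (List.tabulate g) ≡ 0
sum-tabulate-≡0 {zero}  g e = refl
sum-tabulate-≡0 {suc n} g e = cong₂ _+_ (e Fin.zero) (sum-tabulate-≡0 (g ∘ Fin.suc) (e ∘ Fin.suc))

sum-tabulate-single : (g : Fin n → ℕ) (c : Fin n) → (∀ j → j ≢ c → g j ≡ 0) →
  sum (List.tabulate g) ≡ g c
sum-tabulate-single g Fin.zero    e =
  ≡.trans (cong (g Fin.zero +_) (sum-tabulate-≡0 (g ∘ Fin.suc) (λ j → e (Fin.suc j) λ ())))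
          (+-identityʳ _)
sum-tabulate-single g (Fin.suc c) e =
  cong₂ _+_ (e Fin.zero λ ())
            (sum-tabulate-single (g ∘ Fin.suc) c (λ j j≢c → e (Fin.suc j) (j≢c ∘ Finₚ.suc-injective)))

attachColors : (Fin n → Fin r) → Vec ℕ n → Vec (Entry r) n
attachColors c ns = tabulate λ i → lookup ns i , c i

lookup-attachColors : (c : Fin n → Fin r) (ns : Vec ℕ n) (i : Fin n) →
  lookup (attachColors c ns) i ≡ (lookup ns i , c i)
lookup-attachColors c ns = lookup∘tabulate (λ i → lookup ns i , c i)

sum-vecsOf-forcedColors : (L : List ℕ) (P : Vec (Entry r) n → Bool) (c : Fin n → Fin r) →
  (∀ f → P f ≡ true → ∀ i → proj₂ (lookup f i) ≡ c i) →
  sum (map (indicator ∘ P) (vecsOf n (cartesianProduct L (allFin r))))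
    ≡ sum (map (indicator ∘ P ∘ attachColors c) (vecsOf n L))
sum-vecsOf-forcedColors {n = zero}          L P c forced = refl
sum-vecsOf-forcedColors {r = r} {n = suc n} L P c forced = begin
  sum (map (indicator ∘ P) (vecsOf (suc n) LR))
    ≡⟨ sum-map-vecsOf-suc (indicator ∘ P) LR ⟩
  sum (map countFrom LR)
    ≡⟨ sum-map-cartesianProduct countFrom L (allFin r) ⟩
  sum (map (λ a → sum (map (λ b → countFrom (a , b)) (allFin r))) L)
    ≡⟨ sum-map-cong only-forced-color L ⟩
  sum (map (λ a → countFrom (a , c Fin.zero)) L)
    ≡⟨ sum-map-cong (λ a → sum-vecsOf-forcedColors L (P ∘ ((a , c Fin.zero) Vec.∷_)) (c ∘ Fin.suc)
                             (λ f Pf i → forced _ Pf (Fin.suc i))) L ⟩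
  sum (map (λ a → sum (map (indicator ∘ P ∘ attachColors c ∘ (a Vec.∷_)) (vecsOf n L))) L)
    ≡⟨ sum-map-vecsOf-suc (indicator ∘ P ∘ attachColors c) L ⟨
  sum (map (indicator ∘ P ∘ attachColors c) (vecsOf (suc n) L))
    ∎
  where
  open ≡-Reasoning
  LR : List (Entry r)
  LR = cartesianProduct L (allFin r)

  countFrom : Entry r → ℕ
  countFrom e = sum (map (indicator ∘ P ∘ (e Vec.∷_)) (vecsOf n LR))

  other-color : ∀ a b → b ≢ c Fin.zero → countFrom (a , b) ≡ 0
  other-color a b b≢c = sum-map-≡0 rejected (vecsOf n LR)
    where
    rejected : ∀ v → indicator (P ((a , b) Vec.∷ v)) ≡ 0
    rejected v with P ((a , b) Vec.∷ v) in Pv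
    ... | true  = ⊥-elim (b≢c (forced _ Pv Fin.zero))
    ... | false = refl

  only-forced-color : ∀ a → sum (map (λ b → countFrom (a , b)) (allFin r)) ≡ countFrom (a , c Fin.zero)
  only-forced-color a = ≡.trans (cong sum (map-tabulate {n = r} (λ b → b) (λ b → countFrom (a , b))))
                                (sum-tabulate-single _ (c Fin.zero) (other-color a))

toList-tabulate : (g : Fin n → A) → toList (tabulate g) ≡ List.tabulate g
toList-tabulate {n = zero}  g = refl
toList-tabulate {n = suc n} g = cong (g Fin.zero ∷_) (toList-tabulate (g ∘ Fin.suc))

map-toList-tabulate : (h : A → B) (g : Fin n → A) → map h (toList (tabulate g)) ≡ List.tabulate (h ∘ g)
map-toList-tabulate h g = ≡.trans (cong (map h) (toList-tabulate g)) (map-tabulate g h)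

map-injectiveOn : {D : A → Set} (g : A → B) → (∀ {x y} → D x → D y → g x ≡ g y → x ≡ y) →
  ∀ {xs ys} → All D xs → All D ys → map g xs ≡ map g ys → xs ≡ ys
map-injectiveOn g inj []         []         _ = refl
map-injectiveOn g inj (dx ∷ dxs) (dy ∷ dys) e =
  cong₂ _∷_ (inj dx dy (∷-injectiveˡ e)) (map-injectiveOn g inj dxs dys (∷-injectiveʳ e))

Key : Set
Key = ℕ × ColInt

insertKey-↭ : ∀ x ys → insertKey x ys ↭ x ∷ ys
insertKey-↭ x []       = refl
insertKey-↭ x (y ∷ ys) with keyLt x y
... | true  = refl
... | false = trans (prep y (insertKey-↭ x ys)) (swap y x refl)

sortKeys-↭ : ∀ ks → sortKeys ks ↭ ks
sortKeys-↭ []       = refl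
sortKeys-↭ (k ∷ ks) = trans (insertKey-↭ k (sortKeys ks)) (prep k (sortKeys-↭ ks))

insertKey-map : (h : Key → Key) → ∀ x ys → All (λ y → keyLt (h x) (h y) ≡ keyLt x y) ys →
  insertKey (h x) (map h ys) ≡ map h (insertKey x ys)
insertKey-map h x []       []       = refl
insertKey-map h x (y ∷ ys) (e ∷ es) rewrite e with keyLt x y
... | true  = refl
... | false = cong (h y ∷_) (insertKey-map h x ys es)

sortKeys-map : (h : Key → Key) → ∀ ks → AllPairs (λ a b → keyLt (h a) (h b) ≡ keyLt a b) ks →
  sortKeys (map h ks) ≡ map h (sortKeys ks)
sortKeys-map h []       []         = refl
sortKeys-map h (k ∷ ks) (es ∷ ess) = ≡.trans
  (cong (insertKey (h k)) (sortKeys-map h ks ess))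
  (insertKey-map h k (sortKeys ks) (All-resp-↭ (↭-sym (sortKeys-↭ ks)) es))

flatten : ℕ → ℕ
flatten zero    = 0
flatten (suc _) = 1

flattenᶜ : ColInt → ColInt
flattenᶜ (x , c) = x , flatten c

flattenᵏ : Key → Key
flattenᵏ (ν , a) = ν , flattenᶜ a

-- With distinct letters the tie-break on colours is never reached.
flatten-<ᶜ : ∀ a b → proj₁ a ≢ proj₁ b → (flattenᶜ a <ᶜ flattenᶜ b) ≡ (a <ᶜ b)
flatten-<ᶜ (x , zero)  (y , zero)  x≢y = refl
flatten-<ᶜ (x , zero)  (y , suc d) x≢y = refl
flatten-<ᶜ (x , suc c) (y , zero)  x≢y = refl
flatten-<ᶜ (x , suc c) (y , suc d) x≢y rewrite dec-false (x ℕₚ.≟ y) x≢y = refl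

flatten-keyLt : ∀ a b → proj₁ (proj₂ a) ≢ proj₁ (proj₂ b) →
  keyLt (flattenᵏ a) (flattenᵏ b) ≡ keyLt a b
flatten-keyLt (ν , a) (μ , b) a≢b rewrite flatten-<ᶜ a b a≢b = refl

flattenᵉ : Entry r → ℕ × ℕ
flattenᵉ (ν , c) = ν , flatten (toℕ c)

_≈ᵉ_ : Entry r → Entry r → Set
e ≈ᵉ e' = flattenᵉ e ≡ flattenᵉ e'

validEntry-≈ᵉ : (e e' : Entry r) → e ≈ᵉ e' → validEntry e ≡ validEntry e'
validEntry-≈ᵉ (zero  , Fin.zero)  (zero  , Fin.zero)  _  = refl
validEntry-≈ᵉ (zero  , Fin.suc _) (zero  , Fin.suc _) _  = refl
validEntry-≈ᵉ (suc _ , _)         (suc _ , _)         _  = refl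
validEntry-≈ᵉ (zero  , Fin.zero)  (zero  , Fin.suc _) ()
validEntry-≈ᵉ (zero  , Fin.suc _) (zero  , Fin.zero)  ()
validEntry-≈ᵉ (zero  , _)         (suc _ , _)         ()
validEntry-≈ᵉ (suc _ , _)         (zero  , _)         ()

valid-≈ᵉ : {f g : Vec (Entry r) n} → Pointwise _≈ᵉ_ f g → valid f ≡ valid g
valid-≈ᵉ [] = refl
valid-≈ᵉ {f = e Vec.∷ _} {e' Vec.∷ _} (p ∷ ps) = cong₂ _∧_ (validEntry-≈ᵉ e e' p) (valid-≈ᵉ ps)

maxF-≈ᵉ : {f g : Vec (Entry r) n} → Pointwise _≈ᵉ_ f g → maxF f ≡ maxF g
maxF-≈ᵉ []       = refl
maxF-≈ᵉ (p ∷ ps) = cong₂ _⊔_ (cong proj₁ p) (maxF-≈ᵉ ps)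

sizeF-≈ᵉ : {f g : Vec (Entry r) n} → Pointwise _≈ᵉ_ f g → sizeF f ≡ sizeF g
sizeF-≈ᵉ []       = refl
sizeF-≈ᵉ (p ∷ ps) = cong₂ _+_ (cong proj₁ p) (sizeF-≈ᵉ ps)

key : Vec (Entry r) n → Fin n → Key
key f i = proj₁ (lookup f i) , (suc (toℕ i) , toℕ (proj₂ (lookup f i)))

keysOf : Vec (Entry r) n → List Key
keysOf f = toList (tabulate (key f))

keysOf-distinct : (f : Vec (Entry r) n) →
  AllPairs (λ a b → proj₁ (proj₂ a) ≢ proj₁ (proj₂ b)) (keysOf f)
keysOf-distinct f rewrite toList-tabulate (key f) =
  AllPairsₚ.tabulate⁺ (λ i≢j → i≢j ∘ Finₚ.toℕ-injective ∘ ℕₚ.suc-injective)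

piF-flatten : (f : Vec (Entry r) n) → map flattenᶜ (piF f) ≡ map proj₂ (sortKeys (map flattenᵏ (keysOf f)))
piF-flatten f = begin
  map flattenᶜ (map proj₂ (sortKeys (keysOf f)))
    ≡⟨ map-∘ _ ⟨
  map (proj₂ ∘ flattenᵏ) (sortKeys (keysOf f))
    ≡⟨ map-∘ _ ⟩
  map proj₂ (map flattenᵏ (sortKeys (keysOf f)))
    ≡⟨ cong (map proj₂) (sortKeys-map flattenᵏ (keysOf f) comparisons-kept) ⟨
  map proj₂ (sortKeys (map flattenᵏ (keysOf f)))
    ∎
  where
  open ≡-Reasoning
  comparisons-kept : AllPairs (λ a b → keyLt (flattenᵏ a) (flattenᵏ b) ≡ keyLt a b) (keysOf f)
  comparisons-kept = AllPairs.map (λ {a} {b} → flatten-keyLt a b) (keysOf-distinct f)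

piF-≈ᵉ : {f g : Vec (Entry r) n} → Pointwise _≈ᵉ_ f g → map flattenᶜ (piF f) ≡ map flattenᶜ (piF g)
piF-≈ᵉ {f = f} {g} f≈g = begin
  map flattenᶜ (piF f)                            ≡⟨ piF-flatten f ⟩
  map proj₂ (sortKeys (map flattenᵏ (keysOf f)))  ≡⟨ cong (map proj₂ ∘ sortKeys) flattened-keys ⟩
  map proj₂ (sortKeys (map flattenᵏ (keysOf g)))  ≡⟨ piF-flatten g ⟨
  map flattenᶜ (piF g)                            ∎
  where
  open ≡-Reasoning
  flattened-keys : map flattenᵏ (keysOf f) ≡ map flattenᵏ (keysOf g)
  flattened-keys = ≡.trans (map-toList-tabulate flattenᵏ (key f)) (≡.trans
    (tabulate-cong (λ i → cong (λ e → proj₁ e , (suc (toℕ i) , proj₂ e)) (Pointwise.lookup f≈g i)))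
    (≡.sym (map-toList-tabulate flattenᵏ (key g))))

Labelled : (Fin n → ℕ) → ColInt → Set
Labelled {n} ℓ (x , d) = Σ[ i ∈ Fin n ] x ≡ suc (toℕ i) × d ≡ ℓ i

Labelled-cong : {ℓ ℓ' : Fin n → ℕ} → (∀ i → ℓ i ≡ ℓ' i) → ∀ a → Labelled ℓ a → Labelled ℓ' a
Labelled-cong e (_ , _) (i , x≡i , d≡ℓi) = i , x≡i , ≡.trans d≡ℓi (e i)

flattenᶜ-injectiveOn-Labelled : (ℓ : Fin n → ℕ) → ∀ a b → Labelled ℓ a → Labelled ℓ b →
  flattenᶜ a ≡ flattenᶜ b → a ≡ b
flattenᶜ-injectiveOn-Labelled ℓ (_ , _) (_ , _) (i , refl , refl) (j , refl , refl) e
  with Finₚ.toℕ-injective (ℕₚ.suc-injective (cong proj₁ e))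
... | refl = refl

piF-labelled : (f : Vec (Entry r) n) → All (Labelled (λ i → toℕ (proj₂ (lookup f i)))) (piF f)
piF-labelled f = Allₚ.map⁺ (All-resp-↭ (↭-sym (sortKeys-↭ (keysOf f)))
  (subst (All _) (≡.sym (toList-tabulate (key f))) (Allₚ.tabulate⁺ (λ i → i , refl , refl))))

piF-attachColors-labelled : (c : Fin n → Fin r) (ns : Vec ℕ n) →
  All (Labelled (toℕ ∘ c)) (piF (attachColors c ns))
piF-attachColors-labelled c ns = All.map (λ {a} → Labelled-cong relabel a) (piF-labelled (attachColors c ns))
  where
  relabel : ∀ i → toℕ (proj₂ (lookup (attachColors c ns) i)) ≡ toℕ (c i)
  relabel i = cong (toℕ ∘ proj₂) (lookup-attachColors c ns i)

key-∈-piF : (f : Vec (Entry r) n) (i : Fin n) → proj₂ (key f i) ∈ piF f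
key-∈-piF f i = ∈-map⁺ proj₂ (∈-resp-↭ (↭-sym (sortKeys-↭ (keysOf f)))
  (subst (key f i ∈_) (≡.sym (toList-tabulate (key f))) (∈-tabulate⁺ i)))

-- The colour of the letter i + 1 in the window of γ, i.e. the colour γ forces on fᵢ.
colorOf : ColPerm r n → Fin n → Fin r
colorOf γ i = ColPerm.colors γ (ColPerm.perm γ ⟨$⟩ˡ i)

window-labelled : (γ : ColPerm r n) → All (Labelled (toℕ ∘ colorOf γ)) (window γ)
window-labelled (colperm c σ) = subst (All _) (≡.sym (toList-tabulate _))
  (Allₚ.tabulate⁺ (λ j → σ ⟨$⟩ʳ j , refl , cong (toℕ ∘ c) (≡.sym (inverseˡ σ))))

colors-forced : {f : Vec (Entry r) n} {γ : ColPerm r n} → piF f ≡ window γ →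
  ∀ i → proj₂ (lookup f i) ≡ colorOf γ i
colors-forced {f = f} {γ} f↦γ i with All.lookup (window-labelled γ) (subst (_ ∈_) f↦γ (key-∈-piF f i))
... | j , i≡j , same-color rewrite Finₚ.toℕ-injective (ℕₚ.suc-injective i≡j) =
  Finₚ.toℕ-injective same-color

≡ᵇ-true⇒≡ : ∀ x y → (x ≡ᵇ y) ≡ true → x ≡ y
≡ᵇ-true⇒≡ x y e = ≡ᵇ⇒≡ x y (Equivalence.from T-≡ e)

≡ᵇ-refl : ∀ x → (x ≡ᵇ x) ≡ true
≡ᵇ-refl x = Equivalence.to T-≡ (≡⇒≡ᵇ x x refl)

eqWin⇔≡ : ∀ {as bs} → eqWin as bs ≡ true ⇔ as ≡ bs
eqWin⇔≡ {as} {bs} = mk⇔ (sound as bs) (λ { refl → complete as })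
  where
  sound : ∀ as bs → eqWin as bs ≡ true → as ≡ bs
  sound []             []             _ = refl
  sound ((x , c) ∷ as) ((y , d) ∷ bs) e = cong₂ _∷_
    (cong₂ _,_ (≡ᵇ-true⇒≡ x y (∧-conicalˡ _ _ heads)) (≡ᵇ-true⇒≡ c d (∧-conicalʳ _ _ heads)))
    (sound as bs (∧-conicalʳ _ _ e))
    where
    heads : (x ≡ᵇ y) ∧ (c ≡ᵇ d) ≡ true
    heads = ∧-conicalˡ _ _ e
  complete : ∀ as → eqWin as as ≡ true
  complete []             = refl
  complete ((x , c) ∷ as) rewrite ≡ᵇ-refl x | ≡ᵇ-refl c = complete as

Counted : ColPerm r n → ℕ → ℕ → Vec (Entry r) n → Bool
Counted {n = n} γ m k f = valid f ∧ eqWin (piF f) (window γ) ∧ (maxF f ≡ᵇ m) ∧ ((n * m ∸ sizeF f) ≡ᵇ k)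

Counted⇒piF≡window : ∀ (γ : ColPerm r n) m k f → Counted γ m k f ≡ true → piF f ≡ window γ
Counted⇒piF≡window γ m k f e = Equivalence.to eqWin⇔≡ (∧-conicalˡ _ _ (∧-conicalʳ (valid f) _ e))

coeff≡sum-over-values : ∀ (γ : ColPerm r n) m k →
  coeff γ m k ≡ sum (map (indicator ∘ Counted γ m k ∘ attachColors (colorOf γ)) (vecsOf n (upTo (suc m))))
coeff≡sum-over-values {r} {n} γ m k = ≡.trans
  (length-filter≡sum-indicator (Counted γ m k) (candidates r n m))
  (sum-vecsOf-forcedColors (upTo (suc m)) (Counted γ m k) (colorOf γ)
    (λ f e → colors-forced {f = f} {γ} (Counted⇒piF≡window γ m k f e)))

data _≈♭_ {r n : ℕ} : ColPerm r n → ColPerm r n → Set where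
  same-flattening : ∀ {c c' σ} → (∀ i → flatten (toℕ (c i)) ≡ flatten (toℕ (c' i))) →
                    colperm c σ ≈♭ colperm c' σ

≈♭-sym : {γ γ' : ColPerm r n} → γ ≈♭ γ' → γ' ≈♭ γ
≈♭-sym (same-flattening e) = same-flattening (≡.sym ∘ e)

phi-≈♭ : (hr : 2 ≤ r) (γ : ColPerm r n) → phi hr γ ≈♭ γ
phi-≈♭ hr@(s≤s (s≤s _)) γ = same-flattening flattened
  where
  flattened : ∀ i → flatten (toℕ (ColPerm.colors (phi hr γ) i)) ≡ flatten (toℕ (ColPerm.colors γ i))
  flattened i with ColPerm.colors γ i
  ... | Fin.zero  = refl
  ... | Fin.suc _ = refl

window-≈♭ : {γ γ' : ColPerm r n} → γ ≈♭ γ' → map flattenᶜ (window γ) ≡ map flattenᶜ (window γ')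
window-≈♭ (same-flattening {σ = σ} e) = ≡.trans (map-toList-tabulate flattenᶜ _) (≡.trans
  (tabulate-cong (λ i → cong (suc (toℕ (σ ⟨$⟩ʳ i)) ,_) (e i)))
  (≡.sym (map-toList-tabulate flattenᶜ _)))

attachColors-≈♭ : {γ γ' : ColPerm r n} → γ ≈♭ γ' → ∀ ns →
  Pointwise _≈ᵉ_ (attachColors (colorOf γ) ns) (attachColors (colorOf γ') ns)
attachColors-≈♭ (same-flattening {σ = σ} e) ns =
  Pointwise.tabulate⁺ (λ i → cong (lookup ns i ,_) (e (σ ⟨$⟩ˡ i)))

piF≡window-≈♭ : {γ γ' : ColPerm r n} → γ ≈♭ γ' → ∀ ns →
  piF (attachColors (colorOf γ) ns) ≡ window γ → piF (attachColors (colorOf γ') ns) ≡ window γ'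
piF≡window-≈♭ {γ = γ} {γ'} γ≈γ' ns f↦γ = map-injectiveOn flattenᶜ
  (λ {a} {b} → flattenᶜ-injectiveOn-Labelled (toℕ ∘ colorOf γ') a b)
  (piF-attachColors-labelled (colorOf γ') ns) (window-labelled γ') (begin
    map flattenᶜ (piF (attachColors (colorOf γ') ns))  ≡⟨ piF-≈ᵉ (attachColors-≈♭ γ≈γ' ns) ⟨
    map flattenᶜ (piF (attachColors (colorOf γ) ns))   ≡⟨ cong (map flattenᶜ) f↦γ ⟩
    map flattenᶜ (window γ)                            ≡⟨ window-≈♭ γ≈γ' ⟩
    map flattenᶜ (window γ')                           ∎)
  where open ≡-Reasoning

Counted-≈♭ : {γ γ' : ColPerm r n} → γ ≈♭ γ' → ∀ m k ns →
  Counted γ m k (attachColors (colorOf γ) ns) ≡ Counted γ' m k (attachColors (colorOf γ') ns)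
Counted-≈♭ {n = n} {γ} {γ'} γ≈γ' m k ns =
  cong₂ _∧_ (valid-≈ᵉ f≈f') (cong₂ _∧_ same-window (cong₂ _∧_
    (cong (_≡ᵇ m) (maxF-≈ᵉ f≈f')) (cong (λ s → (n * m ∸ s) ≡ᵇ k) (sizeF-≈ᵉ f≈f'))))
  where
  f≈f' : Pointwise _≈ᵉ_ (attachColors (colorOf γ) ns) (attachColors (colorOf γ') ns)
  f≈f' = attachColors-≈♭ γ≈γ' ns

  same-window : eqWin (piF (attachColors (colorOf γ) ns)) (window γ)
              ≡ eqWin (piF (attachColors (colorOf γ') ns)) (window γ')
  same-window = ⇔→≡ (⇔.trans eqWin⇔≡ (⇔.trans
    (mk⇔ (piF≡window-≈♭ γ≈γ' ns) (piF≡window-≈♭ (≈♭-sym γ≈γ') ns)) (⇔.sym eqWin⇔≡)))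

coeff-≈♭ : {γ γ' : ColPerm r n} → γ ≈♭ γ' → ∀ m k → coeff γ m k ≡ coeff γ' m k
coeff-≈♭ {n = n} {γ} {γ'} γ≈γ' m k = begin
  coeff γ m k
    ≡⟨ coeff≡sum-over-values γ m k ⟩
  sum (map (indicator ∘ Counted γ m k ∘ attachColors (colorOf γ)) (vecsOf n (upTo (suc m))))
    ≡⟨ sum-map-cong (cong indicator ∘ Counted-≈♭ γ≈γ' m k) (vecsOf n (upTo (suc m))) ⟩
  sum (map (indicator ∘ Counted γ' m k ∘ attachColors (colorOf γ')) (vecsOf n (upTo (suc m))))
    ≡⟨ coeff≡sum-over-values γ' m k ⟨
  coeff γ' m k
    ∎
  where open ≡-Reasoning

corollary3p15 : (r n : ℕ) → (hr : 2 ≤ r) → (γ : ColPerm r n) → (m k : ℕ) →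
    coeff (phi hr γ) m k ≡ coeff γ m k
corollary3p15 r n hr γ = coeff-≈♭ (phi-≈♭ hr γ)
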